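{- $\mathbf{GR}^\circ$ is a conservative extension of $\mathbf{N}$: for every $\mathcal{L}_\blacksquare$-formula $A$, if $\mathbf{GR}^\circ\vdash A$, then $\mathbf{N}\vdash A$.
   Context: $\mathcal{L}_2$ is the bimodal propositional language with countably many propositional variables, $\bot$, connectives $\neg,\vee$ (others defined), and unary modal operators $\Box,\blacksquare$; $\Diamond$ abbreviates $\neg\Box\neg$. $\mathcal{L}_\blacksquare$ is the $\blacksquare$-fragment of $\mathcal{L}_2$ (formulas without $\Box$). The logic $\mathbf{N}$ in $\mathcal{L}_\blacksquare$ has as axioms all propositional tautologies of $\mathcal{L}_\blacksquare$ and as rules modus ponens and $\blacksquare$-necessitation (from $A$ infer $\blacksquare A$). The logic $\mathbf{GR}^-$ has as axioms all propositional tautologies of $\mathcal{L}_2$ and all instances of $\Box(A\to B)\to(\Box A\to\Box B)$, $\Box(\Box A\to A)\to\Box A$, $\blacksquare A\to\Box A$, $\Box A\to\Box\blacksquare A$, $\Box A\to(\Box\bot\vee\blacksquare A)$, $\Diamond\blacksquare A\to\Diamond A$, and rules modus ponens and $\Box$-necessitation. $\mathbf{GR}^\circ$ is $\mathbf{GR}^-$ plus the rule: from $A$ infer $\blacksquare A$. -}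

module Defs where

open import Data.Nat using (ℕ)
open import Data.Bool using (Bool; true; false; not; _∨_)
open import Data.Unit using (⊤)
open import Data.Product using (_×_)
open import Relation.Binary.PropositionalEquality using (_≡_)

data Fm : Set where
  var : ℕ → Fm
  ⊥'  : Fm
  ¬'_ : Fm → Fm
  _∨'_ : Fm → Fm → Fm
  □_  : Fm → Fm
  ■_  : Fm → Fm

infixr 6 _∨'_
infixr 5 _⇒_
infix 7 ¬'_ □_ ■_ ◇_

_⇒_ : Fm → Fm → Fm
A ⇒ B = (¬' A) ∨' B

◇_ : Fm → Fm
◇ A = ¬' (□ (¬' A))

BoxFree : Fm → Set
BoxFree (var _) = ⊤
BoxFree ⊥' = ⊤
BoxFree (¬' A) = BoxFree A
BoxFree (A ∨' B) = BoxFree A × BoxFree B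
BoxFree (□ A) = Data.Empty.⊥
  where import Data.Empty
BoxFree (■ A) = BoxFree A

eval : (ℕ → Bool) → (Fm → Bool) → Fm → Bool
eval v b (var n) = v n
eval v b ⊥' = false
eval v b (¬' A) = not (eval v b A)
eval v b (A ∨' B) = eval v b A ∨ eval v b B
eval v b (□ A) = b (□ A)
eval v b (■ A) = b (■ A)

Taut : Fm → Set
Taut A = (v : ℕ → Bool) (b : Fm → Bool) → eval v b A ≡ true

data N⊢_ : Fm → Set where
  taut : ∀ {A} → BoxFree A → Taut A → N⊢ A
  mp   : ∀ {A B} → N⊢ (A ⇒ B) → N⊢ A → N⊢ B
  nec■ : ∀ {A} → N⊢ A → N⊢ (■ A)

-- The logic GR° = GR⁻ + ■-necessitation
data GR∘⊢_ : Fm → Set where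
  taut : ∀ {A} → Taut A → GR∘⊢ A
  axK  : ∀ {A B} → GR∘⊢ (□ (A ⇒ B) ⇒ (□ A ⇒ □ B))
  axL  : ∀ {A} → GR∘⊢ (□ (□ A ⇒ A) ⇒ □ A)
  ax1  : ∀ {A} → GR∘⊢ (■ A ⇒ □ A)
  ax2  : ∀ {A} → GR∘⊢ (□ A ⇒ □ (■ A))
  ax3  : ∀ {A} → GR∘⊢ (□ A ⇒ (□ ⊥' ∨' ■ A))
  ax4  : ∀ {A} → GR∘⊢ (◇ (■ A) ⇒ ◇ A)
  mp   : ∀ {A B} → GR∘⊢ (A ⇒ B) → GR∘⊢ A → GR∘⊢ B
  nec□ : ∀ {A} → GR∘⊢ A → GR∘⊢ (□ A)
  nec■ : ∀ {A} → GR∘⊢ A → GR∘⊢ (■ A)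

-- Replace every □-subformula by ⊤. Every GR° axiom then becomes a propositional
-- tautology, the conclusion of □-necessitation becomes ⊤, and modus ponens and
-- ■-necessitation are preserved; so a GR°-derivation of A erases to an
-- N-derivation of the erasure of A, which is A itself when A is □-free.
module Submission where

open import Defs
open import Data.Bool using (Bool; true; false; not; _∨_)
open import Data.Bool.Properties using (∨-zeroʳ)
open import Data.Unit using (tt)
open import Data.Product using (_,_)
open import Relation.Binary.PropositionalEquality using (_≡_; refl; cong; cong₂; trans; subst)

⊤' : Fm
⊤' = ¬' ⊥'

erase□ : Fm → Fm
erase□ (var n) = var n
erase□ ⊥' = ⊥'
erase□ (¬' A) = ¬' erase□ A
erase□ (A ∨' B) = erase□ A ∨' erase□ B
erase□ (□ A) = ⊤'
erase□ (■ A) = ■ erase□ A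

boxFree-erase□ : ∀ A → BoxFree (erase□ A)
boxFree-erase□ (var n) = tt
boxFree-erase□ ⊥' = tt
boxFree-erase□ (¬' A) = boxFree-erase□ A
boxFree-erase□ (A ∨' B) = boxFree-erase□ A , boxFree-erase□ B
boxFree-erase□ (□ A) = tt
boxFree-erase□ (■ A) = boxFree-erase□ A

erase□-boxFree : ∀ A → BoxFree A → erase□ A ≡ A
erase□-boxFree (var n) _ = refl
erase□-boxFree ⊥' _ = refl
erase□-boxFree (¬' A) p = cong ¬'_ (erase□-boxFree A p)
erase□-boxFree (A ∨' B) (p , q) = cong₂ _∨'_ (erase□-boxFree A p) (erase□-boxFree B q)
erase□-boxFree (■ A) p = cong ■_ (erase□-boxFree A p)

-- How b sees the modal atoms of A once A is erased.
erasedAtoms : (Fm → Bool) → Fm → Bool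
erasedAtoms b (□ A) = true
erasedAtoms b (■ A) = b (■ erase□ A)
erasedAtoms b _ = false

eval-erase□ : ∀ v b A → eval v b (erase□ A) ≡ eval v (erasedAtoms b) A
eval-erase□ v b (var n) = refl
eval-erase□ v b ⊥' = refl
eval-erase□ v b (¬' A) = cong not (eval-erase□ v b A)
eval-erase□ v b (A ∨' B) = cong₂ _∨_ (eval-erase□ v b A) (eval-erase□ v b B)
eval-erase□ v b (□ A) = refl
eval-erase□ v b (■ A) = refl

taut-erase□ : ∀ {A} → Taut A → Taut (erase□ A)
taut-erase□ {A} t v b = trans (eval-erase□ v b A) (t v (erasedAtoms b))

N⊢erase□ : ∀ A → Taut (erase□ A) → N⊢ erase□ A
N⊢erase□ A = taut (boxFree-erase□ A)

erase□-sound : ∀ {A} → GR∘⊢ A → N⊢ erase□ A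
erase□-sound {A} (taut t) = N⊢erase□ A (taut-erase□ {A} t)
erase□-sound {A} axK = N⊢erase□ A λ _ _ → refl
erase□-sound {A} axL = N⊢erase□ A λ _ _ → refl
erase□-sound {A} (ax1 {B}) = N⊢erase□ A λ _ b → ∨-zeroʳ (not (b (■ erase□ B)))
erase□-sound {A} ax2 = N⊢erase□ A λ _ _ → refl
erase□-sound {A} ax3 = N⊢erase□ A λ _ _ → refl
erase□-sound {A} ax4 = N⊢erase□ A λ _ _ → refl
erase□-sound (mp d e) = mp (erase□-sound d) (erase□-sound e)
erase□-sound {A} (nec□ d) = N⊢erase□ A λ _ _ → refl
erase□-sound (nec■ d) = nec■ (erase□-sound d)

theorem3p6 : (A : Fm) → BoxFree A → GR∘⊢ A → N⊢ A
theorem3p6 A p d = subst N⊢_ (erase□-boxFree A p) (erase□-sound d)
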